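{- Let $s\ge1$ and let $\pi$ be a partition with exactly $s$ successive lower-Durfee squares. Then $\pi$ has exactly $s$ successive Durfee squares.
   Context: Write a partition $\pi$ as $\lambda_1\ge\dots\ge\lambda_\ell$, row $i$ of its Ferrers diagram (from the top) of length $\lambda_i$. Successive Durfee squares: the first has side $D_1=\max\{i:\lambda_i\ge i\}$ and occupies rows $1,\dots,D_1$; the second is the first Durfee square of the partition $\lambda_{D_1+1}\ge\lambda_{D_1+2}\ge\cdots$, and so on until no parts remain; $\pi$ has exactly $s$ successive Durfee squares if this produces exactly $s$ squares. Successive lower-Durfee squares: set $r_0=\ell$; if $r_{t-1}\ge1$ let $d_t=\min(\lambda_{r_{t-1}},r_{t-1})$, the $t$-th lower-Durfee square being the $d_t\times d_t$ square in the first $d_t$ columns of rows $r_{t-1}-d_t+1,\dots,r_{t-1}$, and $r_t=r_{t-1}-d_t$; stop when $r_t=0$. $\pi$ has exactly $s$ successive lower-Durfee squares if this produces exactly $s$ squares. -}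

module Defs where

open import Data.Nat using (ℕ; zero; suc; _≤_; _≥_; _≤?_; _⊔_; _⊓_; _∸_)
open import Data.List using (List; []; _∷_; _++_; [_]; length; take; drop)
open import Data.List.Relation.Unary.All using (All)
open import Data.List.Relation.Unary.Linked using (Linked)
open import Relation.Nullary using (yes; no)

IsPartition : List ℕ → Set
IsPartition π = All (1 ≤_) π × Linked _≥_ π
  where open import Data.Product using (_×_)

-- durfeeFrom i (λ_i ∷ λ_{i+1} ∷ …) = max { j ≥ i : λ_j ≥ j }  (0 if none)
durfeeFrom : ℕ → List ℕ → ℕ
durfeeFrom i [] = 0
durfeeFrom i (x ∷ xs) with i ≤? x
... | yes _ = i ⊔ durfeeFrom (suc i) xs
... | no  _ = durfeeFrom (suc i) xs

durfee : List ℕ → ℕ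
durfee = durfeeFrom 1

data SuccDurfee : List ℕ → ℕ → Set where
  sd-nil  : SuccDurfee [] 0
  sd-cons : ∀ {s} (x : ℕ) (xs : List ℕ) →
            SuccDurfee (drop (durfee (x ∷ xs)) (x ∷ xs)) s →
            SuccDurfee (x ∷ xs) (suc s)

-- With r = number of remaining rows and λ_r the last remaining part,
-- d = min(λ_r, r); the bottom d rows are removed (r ↦ r - d); repeat until r = 0.
data SuccLowerDurfee : List ℕ → ℕ → Set where
  sld-nil  : SuccLowerDurfee [] 0
  sld-snoc : ∀ {s} (ys : List ℕ) (x : ℕ) →
             SuccLowerDurfee
               (take (length (ys ++ [ x ]) ∸ (x ⊓ length (ys ++ [ x ]))) (ys ++ [ x ]))
               s →
             SuccLowerDurfee (ys ++ [ x ]) (suc s)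

module Submission where

-- Call a run B of consecutive rows a square block if every row in it has
-- length at least the number |B| of rows, i.e. B contains a |B|×|B| square.
--
-- Both kinds of successive Durfee squares are greedy cuttings of a list of
-- rows into square blocks: the Durfee square takes the longest square block
-- that is a prefix of π, and the lower-Durfee square takes the longest square
-- block that is a prefix of reverse π (the bottom rows read upwards).
--
-- For any property of blocks that is closed under taking suffixes, a greedy
-- cutting uses the fewest blocks among all cuttings (the usual "greedy stays
-- ahead" exchange argument).  Square blocks are also closed under reversal,
-- so cuttings of π and of reverse π correspond, and greedy cuttings of π and
-- of reverse π therefore have the same number of blocks.

open import Defs
open import Data.Nat using (ℕ; _≤_)
open import Data.List using (List)

open import Data.Nat using (suc; _≥_; _≤?_; _⊔_; _⊓_; _∸_; _+_; _<_; z≤n; s≤s)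
open import Data.Nat.Properties
open import Data.List using ([]; _∷_; _++_; [_]; length; take; drop; reverse)
open import Data.List.Properties
  using (++-conicalˡ; ++-conicalʳ; ++-assoc; ++-identityʳ; ∷-injective; length-++;
         length-++-≤ˡ; length-++-≤ʳ; length-take; length-drop; take++drop≡id;
         reverse-++; reverse-involutive; length-reverse)
open import Data.List.Relation.Unary.All as All using (All; []; _∷_)
open import Data.List.Relation.Unary.All.Properties using (++⁻ʳ; drop⁺; take⁺)
open import Data.List.Relation.Unary.AllPairs using (_∷_)
import Data.List.Relation.Unary.AllPairs.Properties as AllPairs
open import Data.List.Relation.Unary.Linked as Linked using (Linked; _∷_)
open import Data.List.Relation.Unary.Linked.Properties using (Linked⇒AllPairs; AllPairs⇒Linked)
open import Data.List.Relation.Binary.Permutation.Propositional using (↭-sym)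
open import Data.List.Relation.Binary.Permutation.Propositional.Properties
  using (↭-reverse; All-resp-↭)
open import Data.Product using (∃; ∃-syntax; _×_; _,_)
open import Data.Sum using (_⊎_; inj₁; inj₂)
open import Data.Empty using (⊥-elim)
open import Relation.Nullary using (yes; no)
open import Relation.Binary.PropositionalEquality hiding ([_])

++-split : ∀ {A : Set} (P X B Y : List A) → P ++ X ≡ B ++ Y →
  (∃[ Q ] P ≡ B ++ Q × Y ≡ Q ++ X) ⊎
  (∃[ C ] 0 < length C × B ≡ P ++ C × X ≡ C ++ Y)
++-split []      X []      Y eq = inj₁ ([] , refl , sym eq)
++-split []      X (b ∷ B) Y eq = inj₂ (b ∷ B , s≤s z≤n , refl , eq)
++-split (p ∷ P) X []      Y eq = inj₁ (p ∷ P , refl , sym eq)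
++-split (p ∷ P) X (b ∷ B) Y eq with ∷-injective eq
... | refl , eq′ with ++-split P X B Y eq′
...   | inj₁ (Q , P≡BQ , Y≡QX)       = inj₁ (Q , cong (p ∷_) P≡BQ , Y≡QX)
...   | inj₂ (C , pos , B≡PC , X≡CY) = inj₂ (C , pos , cong (p ∷_) B≡PC , X≡CY)

module Cuttings {A : Set} (Block : List A → Set) where

  data Cutting : List A → ℕ → Set where
    cut-done : Cutting [] 0
    cut-next : ∀ {M L k} (B : List A) → M ≡ B ++ L → Block B →
               Cutting L k → Cutting M (suc k)

  LongestPrefix : List A → List A → Set
  LongestPrefix M B = ∀ C Y → M ≡ C ++ Y → Block C → length C ≤ length B

  data Greedy : List A → ℕ → Set where
    greedy-done : Greedy [] 0
    greedy-next : ∀ {M L t} (B : List A) → M ≡ B ++ L → 0 < length B → Block B →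
                  LongestPrefix M B → Greedy L t → Greedy M (suc t)

  greedy⇒cutting : ∀ {M t} → Greedy M t → Cutting M t
  greedy⇒cutting greedy-done = cut-done
  greedy⇒cutting (greedy-next B M≡BL _ block _ g) = cut-next B M≡BL block (greedy⇒cutting g)

  cutting-snoc : ∀ {M k} → Cutting M k → ∀ B → Block B → Cutting (M ++ B) (suc k)
  cutting-snoc cut-done B block = cut-next B (sym (++-identityʳ B)) block cut-done
  cutting-snoc (cut-next {L = L} B₁ M≡B₁L block₁ c) B block =
    cut-next B₁ (trans (cong (_++ B) M≡B₁L) (++-assoc B₁ L B)) block₁ (cutting-snoc c B block)

  module _ (reverse-closed : ∀ B → Block B → Block (reverse B)) where

    cutting-reverse : ∀ {M k} → Cutting M k → Cutting (reverse M) k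
    cutting-reverse cut-done = cut-done
    cutting-reverse (cut-next {L = L} B M≡BL block c) =
      subst (λ Z → Cutting Z _) (sym (trans (cong reverse M≡BL) (reverse-++ B L)))
        (cutting-snoc (cutting-reverse c) (reverse B) (reverse-closed B block))

  -- Compare the first greedy block B of L with the first block B₁ of the
  -- cutting: if B₁ ends before L starts, drop it; otherwise the part C of B₁
  -- inside L is a block prefix of L, so it cannot extend beyond B, and both
  -- cuttings advance by one block.
  module _ (suffix-closed : ∀ P C → Block (P ++ C) → Block C) where

    greedy-optimal : ∀ {L t M k} → Greedy L t → Cutting M k → ∀ P → M ≡ P ++ L → t ≤ k
    greedy-optimal greedy-done _ _ _ = z≤n
    greedy-optimal (greedy-next {L = L′} B L≡BL′ pos _ _ _) cut-done P []≡PL =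
      ⊥-elim (n≮0 (subst (λ Z → 0 < length Z) B≡[] pos))
      where
      B≡[] : B ≡ []
      B≡[] = ++-conicalˡ B L′ (++-conicalʳ P _ (sym (trans []≡PL (cong (P ++_) L≡BL′))))
    greedy-optimal g@(greedy-next {L = L′} B L≡BL′ _ _ longest g′) (cut-next {L = M₁} B₁ M≡B₁M₁ block₁ c) P M≡PL
      with ++-split P _ B₁ M₁ (trans (sym M≡PL) M≡B₁M₁)
    ... | inj₁ (Q , _ , M₁≡QL) = m≤n⇒m≤1+n (greedy-optimal g c Q M₁≡QL)
    ... | inj₂ (C , _ , B₁≡PC , L≡CM₁) with ++-split B L′ C M₁ (trans (sym L≡BL′) L≡CM₁)
    ...   | inj₁ (Q , _ , M₁≡QL′) = s≤s (greedy-optimal g′ c Q M₁≡QL′)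
    ...   | inj₂ (C′ , C′-pos , C≡BC′ , _) = ⊥-elim (<⇒≱ B<C C≤B)
      where
      C≤B : length C ≤ length B
      C≤B = longest C M₁ L≡CM₁ (suffix-closed P C (subst Block B₁≡PC block₁))
      B<C : length B < length C
      B<C = subst (length B <_) (sym (trans (cong length C≡BC′) (length-++ B)))
                  (m<m+n (length B) C′-pos)

  -- For suffix- and reversal-closed blocks, greedy cuttings of M and of
  -- reverse M have the same number of blocks: each is optimal and cuttings
  -- of M and of reverse M correspond.
  greedy-reverse-count : (∀ P C → Block (P ++ C) → Block C) →
    (∀ B → Block B → Block (reverse B)) →
    ∀ {M t s} → Greedy M t → Greedy (reverse M) s → t ≡ s
  greedy-reverse-count suffix-closed reverse-closed {M} g gʳ = ≤-antisym
    (greedy-optimal suffix-closed g (subst (λ Z → Cutting Z _) (reverse-involutive M)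
      (cutting-reverse reverse-closed (greedy⇒cutting gʳ))) [] refl)
    (greedy-optimal suffix-closed gʳ (cutting-reverse reverse-closed (greedy⇒cutting g)) [] refl)

IsSquareBlock : List ℕ → Set
IsSquareBlock B = All (length B ≤_) B

square-suffix : ∀ P C → IsSquareBlock (P ++ C) → IsSquareBlock C
square-suffix P C sq = All.map (≤-trans (length-++-≤ʳ C {P})) (++⁻ʳ P sq)

square-reverse : ∀ B → IsSquareBlock B → IsSquareBlock (reverse B)
square-reverse B sq rewrite length-reverse B = All-resp-↭ (↭-sym (↭-reverse B)) sq

square-take : ∀ d (L : List ℕ) → All (d ≤_) (take d L) → IsSquareBlock (take d L)
square-take d L bound =
  All.map (≤-trans (≤-trans (≤-reflexive (length-take d L)) (m⊓n≤m d _))) bound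

open Cuttings IsSquareBlock

≥-trans : ∀ {i j k : ℕ} → i ≥ j → j ≥ k → i ≥ k
≥-trans j≤i k≤j = ≤-trans k≤j j≤i

partition-take : ∀ n {π} → IsPartition π → IsPartition (take n π)
partition-take n (pos , dec) =
  take⁺ n pos , AllPairs⇒Linked (AllPairs.take⁺ n (Linked⇒AllPairs ≥-trans dec))

partition-drop : ∀ n {π} → IsPartition π → IsPartition (drop n π)
partition-drop n (pos , dec) =
  drop⁺ n pos , AllPairs⇒Linked (AllPairs.drop⁺ n (Linked⇒AllPairs ≥-trans dec))

durfeeFrom-cons : ∀ i x xs → durfeeFrom (suc i) xs ≤ durfeeFrom i (x ∷ xs)
durfeeFrom-cons i x xs with i ≤? x
... | yes _ = m≤n⊔m i _
... | no  _ = ≤-refl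

durfee-max : ∀ i c C R → All (i + length C ≤_) (c ∷ C) → i + length C ≤ durfeeFrom i (c ∷ C ++ R)
durfee-max i c [] R (i+0≤c ∷ []) with i ≤? c
... | yes _   = ≤-trans (≤-reflexive (+-identityʳ i)) (m≤m⊔n i _)
... | no  i≰c = ⊥-elim (i≰c (subst (_≤ c) (+-identityʳ i) i+0≤c))
durfee-max i c (c′ ∷ C) R (_ ∷ bound) = begin
  i + suc (length C)              ≡⟨ +-suc i (length C) ⟩
  suc i + length C                ≤⟨ durfee-max (suc i) c′ C R (subst (λ m → All (m ≤_) (c′ ∷ C)) (+-suc i _) bound) ⟩
  durfeeFrom (suc i) (c′ ∷ C ++ R) ≤⟨ durfeeFrom-cons i c _ ⟩
  durfeeFrom i (c ∷ c′ ∷ C ++ R)  ∎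
  where open ≤-Reasoning

DurfeeAttained : ℕ → List ℕ → ℕ → Set
DurfeeAttained i L D = D ≡ 0 ⊎ ∃[ k ] D ≡ i + k × All (D ≤_) (take (suc k) L)

attained-here : ∀ {i x} xs → i ≤ x → DurfeeAttained i (x ∷ xs) i
attained-here _ i≤x = inj₂ (0 , sym (+-identityʳ _) , i≤x ∷ [])

durfee-attained : ∀ i L → Linked _≥_ L → DurfeeAttained i L (durfeeFrom i L)
durfee-attained i [] _ = inj₁ refl
durfee-attained i (x ∷ []) _ with i ≤? x
... | yes i≤x = subst (DurfeeAttained i (x ∷ [])) (sym (⊔-identityʳ i)) (attained-here [] i≤x)
... | no  _   = inj₁ refl
durfee-attained i (x ∷ y ∷ ys) dec@(y≤x ∷ _) with i ≤? x | durfee-attained (suc i) (y ∷ ys) (Linked.tail dec)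
... | yes i≤x | inj₁ D′≡0 =
  subst (DurfeeAttained i _) (sym (trans (cong (i ⊔_) D′≡0) (⊔-identityʳ i))) (attained-here _ i≤x)
... | yes _   | inj₂ (k , D′≡ , D′≤y ∷ bound) =
  subst (DurfeeAttained i _) (sym (m≤n⇒m⊔n≡n (subst (i ≤_) (sym D′≡) (m≤n⇒m≤1+n (m≤m+n i k)))))
    (inj₂ (suc k , trans D′≡ (sym (+-suc i k)) , ≤-trans D′≤y y≤x ∷ D′≤y ∷ bound))
... | no  _   | inj₁ D′≡0 = inj₁ D′≡0
... | no  i≰x | inj₂ (k , D′≡ , D′≤y ∷ _) =
  ⊥-elim (i≰x (≤-trans (subst (i ≤_) (sym D′≡) (m≤n⇒m≤1+n (m≤m+n i k))) (≤-trans D′≤y y≤x)))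

durfee-square : ∀ L → Linked _≥_ L → IsSquareBlock (take (durfee L) L)
durfee-square L dec = square-take (durfee L) L (bound (durfee L) (durfee-attained 1 L dec))
  where
  bound : ∀ D → DurfeeAttained 1 L D → All (D ≤_) (take D L)
  bound .0       (inj₁ refl)            = []
  bound .(suc k) (inj₂ (k , refl , b)) = b

durfee-longest : ∀ L → LongestPrefix L (take (durfee L) L)
durfee-longest L [] Y _ _ = z≤n
durfee-longest .(c ∷ C ++ Y) (c ∷ C) Y refl sq =
  subst (length (c ∷ C) ≤_) (sym (length-take (durfee L′) L′))
    (⊓-glb (durfee-max 1 c C Y sq) (length-++-≤ˡ (c ∷ C)))
  where L′ = c ∷ C ++ Y

durfee-positive : ∀ x xs → 1 ≤ x → 1 ≤ durfee (x ∷ xs)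
durfee-positive x xs 1≤x = durfee-max 1 x [] xs (1≤x ∷ [])

succDurfee⇒greedy : ∀ {π t} → IsPartition π → SuccDurfee π t → Greedy π t
succDurfee⇒greedy _ sd-nil = greedy-done
succDurfee⇒greedy part@(1≤x ∷ _ , dec) (sd-cons x xs rest) =
  greedy-next (take D π) (sym (take++drop≡id D π)) pos (durfee-square π dec) (durfee-longest π)
    (succDurfee⇒greedy (partition-drop D part) rest)
  where
  π = x ∷ xs
  D = durfee π
  pos : 0 < length (take D π)
  pos = subst (0 <_) (sym (length-take D π)) (⊓-glb (durfee-positive x xs 1≤x) (s≤s z≤n))

-- The Durfee process terminates: each step removes at least one row.
succDurfee-exists : ∀ n π → length π ≤ n → IsPartition π → ∃ (SuccDurfee π)
succDurfee-exists _       []       _         _ = 0 , sd-nil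
succDurfee-exists (suc n) (x ∷ xs) (s≤s len) part@(1≤x ∷ _ , _)
  with succDurfee-exists n (drop D (x ∷ xs)) shorter (partition-drop D part)
  where
  D = durfee (x ∷ xs)
  shorter : length (drop D (x ∷ xs)) ≤ n
  shorter with D | durfee-positive x xs 1≤x
  ... | suc D′ | _ = ≤-trans (≤-reflexive (length-drop D′ xs)) (≤-trans (m∸n≤m _ D′) len)
... | t , sd = suc t , sd-cons x xs sd

last-least : ∀ ys {x} → Linked _≥_ (ys ++ [ x ]) → All (x ≤_) (ys ++ [ x ])
last-least [] _ = ≤-refl ∷ []
last-least (y ∷ ys) dec with Linked⇒AllPairs ≥-trans dec
... | y≥rest ∷ _ = All.head (++⁻ʳ ys y≥rest) ∷ last-least ys (Linked.tail dec)

-- Successive lower-Durfee squares of π, read from the bottom, form the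
-- greedy square-block cutting of reverse π: the bottom d = min(x, r) rows
-- are all ≥ x ≥ d, and a square block at the bottom has at most x rows
-- (the last row x belongs to it) and at most r rows.
succLowerDurfee⇒greedy : ∀ {π s} → IsPartition π → SuccLowerDurfee π s → Greedy (reverse π) s
succLowerDurfee⇒greedy _ sld-nil = greedy-done
succLowerDurfee⇒greedy part@(pos , dec) (sld-snoc ys x rest) =
  greedy-next (reverse (drop n π)) split-eq B-pos B-square longest
    (succLowerDurfee⇒greedy (partition-take n part) rest)
  where
  π = ys ++ [ x ]
  r = length π
  d = x ⊓ r
  n = r ∸ d
  B-length : length (reverse (drop n π)) ≡ d
  B-length = trans (length-reverse (drop n π))
                   (trans (length-drop n π) (m∸[m∸n]≡n (m⊓n≤n x r)))
  split-eq : reverse π ≡ reverse (drop n π) ++ reverse (take n π)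
  split-eq = trans (cong reverse (sym (take++drop≡id n π))) (reverse-++ (take n π) (drop n π))
  B-pos : 0 < length (reverse (drop n π))
  B-pos = subst (0 <_) (sym B-length)
                (⊓-glb (All.head (++⁻ʳ ys pos)) (length-++-≤ʳ [ x ] {ys}))
  B-square : IsSquareBlock (reverse (drop n π))
  B-square = square-reverse (drop n π)
    (subst (λ m → All (m ≤_) (drop n π)) (sym (trans (sym (length-reverse (drop n π))) B-length))
      (All.map (≤-trans (m⊓n≤m x r)) (drop⁺ n (last-least ys dec))))
  longest : LongestPrefix (reverse π) (reverse (drop n π))
  longest [] Y _ _ = z≤n
  longest (c ∷ C) Y revπ≡ (c≥ ∷ _) with ∷-injective (trans (sym (reverse-++ ys [ x ])) revπ≡)
  ... | refl , _ = subst (length (c ∷ C) ≤_) (sym B-length)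
    (⊓-glb c≥ (subst (length (c ∷ C) ≤_) (trans (cong length (sym revπ≡)) (length-reverse π))
                     (length-++-≤ˡ (c ∷ C))))

-- Lemma 3.3: exactly s successive lower-Durfee squares implies exactly s
-- successive Durfee squares.
lemma3p3 : (s : ℕ) (π : List ℕ) → 1 ≤ s → IsPartition π →
    SuccLowerDurfee π s → SuccDurfee π s
lemma3p3 s π _ part lower with succDurfee-exists (length π) π ≤-refl part
... | t , upper = subst (SuccDurfee π) t≡s upper
  where
  t≡s : t ≡ s
  t≡s = greedy-reverse-count square-suffix square-reverse
          (succDurfee⇒greedy part upper) (succLowerDurfee⇒greedy part lower)
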